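{- Let $(\alpha,k)$ be a trimmed and compressed VS-SDD with respect to a vtree $v$. If $\langle\alpha,k\rangle=\mathit{false}$ then $\alpha=\bot$; if $\langle\alpha,k\rangle=\mathit{true}$ then $\alpha=\top$; otherwise $\mathtt{ID}^{ -1}(k)$ equals the vtree node on which $\langle\alpha,k\rangle$ essentially depends.
   Context: A vtree over a set of variables is an ordered full binary tree whose leaves are in one-to-one correspondence with the variables; $l(x)$ denotes the variable of leaf $x$. Each vtree node $x$ is assigned an integer ID $\mathtt{ID}(x)$ following a preorder traversal; $\mathtt{ID}^{ -1}(i)$ is the node with ID $i$. A node $y$ is a left (resp. right) descendant of $x$ if $y$ is a (not necessarily proper) descendant of the left (resp. right) child of $x$. For disjoint variable sets $\mathbf{X},\mathbf{Y}$, an $\mathbf{X}$-partition of $f(\mathbf{X},\mathbf{Y})$ is an expression $f=\bigvee_{i=1}^n[p_i(\mathbf{X})\wedge s_i(\mathbf{Y})]$ with $p_i\wedge p_j=\mathit{false}$ for $i\ne j$, $\bigvee_i p_i=\mathit{true}$, $p_i\ne\mathit{false}$; it is compressed if the $s_i$ are pairwise distinct. A VS-SDD is a pair $(\alpha,k)$ of a structure $\alpha$ and integer offset $k$, with semantics $\langle\alpha,k\rangle$: (constant) $\alpha=\top$ or $\bot$, $\langle\top,\cdot\rangle=\mathit{true}$, $\langle\bot,\cdot\rangle=\mathit{false}$; (literal) $\alpha=\mathbf{v}$ or $\neg\mathbf{v}$ where $\mathtt{ID}^{ -1}(k)$ is a leaf, $\langle\mathbf{v},k\rangle=l(\mathtt{ID}^{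 -1}(k))$, $\langle\neg\mathbf{v},k\rangle=\neg l(\mathtt{ID}^{ -1}(k))$; (decomposition) $\alpha=\{([p_1,d_1],[s_1,e_1]),\ldots,([p_n,d_n],[s_n,e_n])\}$ where $\mathtt{ID}^{ -1}(k)$ is internal, $\mathtt{ID}^{ -1}(d_i+k)$ is a left descendant and $\mathtt{ID}^{ -1}(e_i+k)$ a right descendant of $\mathtt{ID}^{ -1}(k)$, and $\langle p_i,d_i+k\rangle$ form a partition; $\langle\alpha,k\rangle=\bigvee_i(\langle p_i,d_i+k\rangle\wedge\langle s_i,e_i+k\rangle)$. A VS-SDD is compressed if every decomposition in it forms a compressed partition; trimmed if it contains no decomposition of the form $\{([\top,\cdot],[\beta,d])\}$ or $\{([\beta,d],[\top,\cdot]),([\neg\beta,d],[\bot,\cdot])\}$. $f$ essentially depends on variable $X$ if $f|X\ne f|\neg X$; $f$ essentially depends on vtree node $x$ if $f$ is non-trivial and $x$ is the deepest vtree node whose leaves include all variables $f$ essentially depends on. -}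

module Defs where

open import Data.Nat using (ℕ; zero; suc; _+_; _∸_; _≤_; _<_; _<ᵇ_; _≡ᵇ_)
open import Data.Integer using (ℤ; +_) renaming (_+_ to _+ℤ_)
open import Data.Bool using (Bool; true; false; if_then_else_; _∧_; _∨_; not)
open import Data.List using (List; []; _∷_; _++_; length; lookup)
open import Data.List.Membership.Propositional using (_∈_)
open import Data.List.Relation.Unary.Unique.Propositional using (Unique)
open import Data.Maybe using (Maybe; just; nothing)
open import Data.Fin using (Fin)
open import Data.Product using (Σ; ∃; ∃-syntax; _×_; _,_)
open import Data.Sum using (_⊎_)
open import Data.Unit using (⊤)
open import Relation.Binary.PropositionalEquality using (_≡_; _≢_)
open import Relation.Nullary using (¬_)

data VT : Set where
  leaf : ℕ → VT
  node : VT → VT → VT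

leaves : VT → List ℕ
leaves (leaf x)   = x ∷ []
leaves (node l r) = leaves l ++ leaves r

WFVtree : VT → Set
WFVtree v = Unique (leaves v)

size : VT → ℕ
size (leaf _)   = 1
size (node l r) = suc (size l + size r)

-- ID⁻¹ : the subtree rooted at the node with preorder ID i (root has ID 0)
at : VT → ℕ → Maybe VT
at t          zero    = just t
at (leaf _)   (suc n) = nothing
at (node l r) (suc n) = if n <ᵇ size l then at l n else at r (n ∸ size l)

-- node IDs are integers in VS-SDDs; negative ones denote no node
atℤ : VT → ℤ → Maybe VT
atℤ v (+ n)         = at v n
atℤ v (Data.Integer.-[1+ n ]) = nothing

Desc : VT → ℕ → ℕ → Set
Desc v i j = ∃[ t ] (at v i ≡ just t × i ≤ j × j < i + size t)

ProperDesc : VT → ℕ → ℕ → Set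
ProperDesc v i j = Desc v i j × i < j

LeftDescℕ : VT → ℕ → ℕ → Set
LeftDescℕ v i j = ∃[ l ] ∃[ r ] (at v i ≡ just (node l r) × suc i ≤ j × j < suc i + size l)

RightDescℕ : VT → ℕ → ℕ → Set
RightDescℕ v i j = ∃[ l ] ∃[ r ] (at v i ≡ just (node l r) × suc i + size l ≤ j × j < suc i + size l + size r)

LeftDesc : VT → ℤ → ℤ → Set
LeftDesc v k j = ∃[ i ] ∃[ j' ] (k ≡ + i × j ≡ + j' × LeftDescℕ v i j')

RightDesc : VT → ℤ → ℤ → Set
RightDesc v k j = ∃[ i ] ∃[ j' ] (k ≡ + i × j ≡ + j' × RightDescℕ v i j')

IsLeafAt : VT → ℤ → Set
IsLeafAt v k = ∃[ x ] (atℤ v k ≡ just (leaf x))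

IsInternalAt : VT → ℤ → Set
IsInternalAt v k = ∃[ l ] ∃[ r ] (atℤ v k ≡ just (node l r))

Assignment : Set
Assignment = ℕ → Bool

BoolFun : Set
BoolFun = Assignment → Bool

-- VS-SDD structures.  A decomposition {([p₁,d₁],[s₁,e₁]),…} is a list of
-- elements  elem pᵢ dᵢ sᵢ eᵢ.

data Struct : Set
data Elem : Set

data Struct where
  top bot pos neg : Struct
  dec : List Elem → Struct

data Elem where
  elem : Struct → ℤ → Struct → ℤ → Elem

-- value of the variable at the leaf with ID k (junk value if not a leaf)
litVal : VT → ℤ → Assignment → Bool
litVal v k a with atℤ v k
... | just (leaf x) = a x
... | _             = false

sem  : VT → Struct → ℤ → BoolFun
semL : VT → List Elem → ℤ → BoolFun

sem v top     k a = true
sem v bot     k a = false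
sem v pos     k a = litVal v k a
sem v neg     k a = not (litVal v k a)
sem v (dec es) k a = semL v es k a

semL v []                   k a = false
semL v (elem p d s e ∷ es)  k a =
  (sem v p (d +ℤ k) a ∧ sem v s (e +ℤ k) a) ∨ semL v es k a

primeSem : VT → (es : List Elem) → ℤ → Fin (length es) → BoolFun
primeSem v es k i with lookup es i
... | elem p d s e = sem v p (d +ℤ k)

subSem : VT → (es : List Elem) → ℤ → Fin (length es) → BoolFun
subSem v es k i with lookup es i
... | elem p d s e = sem v s (e +ℤ k)

IsPartition : VT → List Elem → ℤ → Set
IsPartition v es k =
  (∀ (i j : Fin (length es)) → i ≢ j → ∀ a → (primeSem v es k i a ∧ primeSem v es k j a) ≡ false)
  × (∀ a → ∃[ i ] (primeSem v es k i a ≡ true))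
  × (∀ i → ∃[ a ] (primeSem v es k i a ≡ true))

IsCompressedPartition : VT → List Elem → ℤ → Set
IsCompressedPartition v es k =
  ∀ (i j : Fin (length es)) → i ≢ j → ¬ (∀ a → subSem v es k i a ≡ subSem v es k j a)

Valid  : VT → Struct → ℤ → Set
ValidL : VT → List Elem → ℤ → Set

Valid v top k = ⊤
Valid v bot k = ⊤
Valid v pos k = IsLeafAt v k
Valid v neg k = IsLeafAt v k
Valid v (dec es) k = IsInternalAt v k × ValidL v es k × IsPartition v es k

ValidL v [] k = ⊤
ValidL v (elem p d s e ∷ es) k =
  LeftDesc v k (d +ℤ k) × RightDesc v k (e +ℤ k)
  × Valid v p (d +ℤ k) × Valid v s (e +ℤ k) × ValidL v es k

Compressed  : VT → Struct → ℤ → Set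
CompressedL : VT → List Elem → ℤ → Set

Compressed v (dec es) k = IsCompressedPartition v es k × CompressedL v es k
Compressed v _ k = ⊤

CompressedL v [] k = ⊤
CompressedL v (elem p d s e ∷ es) k =
  Compressed v p (d +ℤ k) × Compressed v s (e +ℤ k) × CompressedL v es k

-- the two forbidden ("untrimmed") decomposition shapes:
--   {([⊤,·],[β,d])}   and   {([β,d],[⊤,·]),([¬β,d],[⊥,·])}
-- (the second one given in either list order; its primes are
--  complementary by the partition condition)
TrimForm : List Elem → Set
TrimForm es =
  (∃[ d ] ∃[ β ] ∃[ e ] (es ≡ elem top d β e ∷ []))
  ⊎ (∃[ β ] ∃[ d ] ∃[ e ] ∃[ γ ] ∃[ d' ] ∃[ e' ] (es ≡ elem β d top e ∷ elem γ d' bot e' ∷ []))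
  ⊎ (∃[ β ] ∃[ d ] ∃[ e ] ∃[ γ ] ∃[ d' ] ∃[ e' ] (es ≡ elem γ d' bot e' ∷ elem β d top e ∷ []))

Trimmed  : Struct → Set
TrimmedL : List Elem → Set

Trimmed (dec es) = ¬ TrimForm es × TrimmedL es
Trimmed _ = ⊤

TrimmedL [] = ⊤
TrimmedL (elem p d s e ∷ es) = Trimmed p × Trimmed s × TrimmedL es

update : Assignment → ℕ → Bool → Assignment
update a X b y = if y ≡ᵇ X then b else a y

DependsOn : BoolFun → ℕ → Set
DependsOn f X = ¬ (∀ a → f (update a X true) ≡ f (update a X false))

NonTrivial : BoolFun → Set
NonTrivial f = ¬ (∀ a → f a ≡ true) × ¬ (∀ a → f a ≡ false)

Covers : VT → ℕ → BoolFun → Set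
Covers v i f = ∃[ t ] (at v i ≡ just t × (∀ X → DependsOn f X → X ∈ leaves t))

EssDepNode : VT → BoolFun → ℕ → Set
EssDepNode v f i =
  NonTrivial f × Covers v i f × (∀ j → ProperDesc v i j → ¬ Covers v j f)

-- Let the decomposition {(pᵢ, sᵢ)} of f sit at the vtree node with children l and r. Primes
-- only read the variables of l and subs only those of r (the leaves are distinct), so splicing
-- a point wᵢ of pᵢ on l with an arbitrary b elsewhere gives f = sᵢ(b). Trimming forces at least
-- two elements, and then compression (distinct subs) makes f non-constant; by induction only
-- ⊥ and ⊤ denote constants. Every variable f depends on lies below the node. If a proper
-- descendant covered them all, f would depend only on the variables of l or only on those of
-- r. The latter makes all subs equal; the former makes every sub a constant, and pairwise
-- distinct Boolean constants leave only the pair (⊤, ⊥), which trimming forbids.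

module Submission where

open import Defs
open import Data.Bool using (Bool; true; false; not; _∧_; _∨_; if_then_else_)
open import Data.Bool.Properties using (∨-identityʳ; not-¬; ¬-not)
open import Data.Empty using (⊥; ⊥-elim)
open import Data.Fin using (Fin; zero; suc)
import Data.Fin.Properties as Fin
open import Data.Integer using (ℤ; +_; -[1+_]) renaming (_+_ to _+ℤ_)
open import Data.List using (List; []; _∷_; _++_; length; lookup)
open import Data.List.Membership.Propositional using (_∈_)
open import Data.List.Membership.Propositional.Properties using (∈-++⁺ˡ; ∈-++⁺ʳ)
open import Data.List.Relation.Binary.Disjoint.Propositional using (Disjoint)
open import Data.List.Relation.Binary.Subset.Propositional using (_⊆_)
open import Data.List.Relation.Binary.Subset.Propositional.Properties using (xs⊆xs++ys; xs⊆ys++xs)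
open import Data.List.Relation.Unary.Any using (here; there)
import Data.List.Relation.Unary.All as All
import Data.List.Relation.Unary.All.Properties as All
open import Data.List.Relation.Unary.AllPairs using ([]; _∷_)
open import Data.List.Relation.Unary.Unique.Propositional using (Unique)
open import Data.Maybe using (just)
open import Data.Nat using (ℕ; zero; suc; _+_; _∸_; _≤_; _<_; _<ᵇ_; _≡ᵇ_; z<s; s≤s; _≟_)
open import Data.Nat.Properties
open import Data.List.Membership.DecPropositional _≟_ using (_∈?_)
open import Data.Product using (∃-syntax; _×_; _,_; proj₁; proj₂)
open import Data.Sum using (_⊎_; inj₁; inj₂)
open import Function using (_∘_)
open import Relation.Binary.PropositionalEquality
open import Relation.Nullary using (¬_; yes; no; does; contradiction; ofʸ; ofⁿ)

at-node-left : ∀ {l r m} → m < size l → at (node l r) (suc m) ≡ at l m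
at-node-left {l} {m = m} m<l with m <ᵇ size l | <ᵇ-reflects-< m (size l)
... | true  | _       = refl
... | false | ofⁿ m≮l = contradiction m<l m≮l

at-node-right : ∀ {l r m} → size l ≤ m → at (node l r) (suc m) ≡ at r (m ∸ size l)
at-node-right {l} {m = m} l≤m with m <ᵇ size l | <ᵇ-reflects-< m (size l)
... | true  | ofʸ m<l = contradiction l≤m (<⇒≱ m<l)
... | false | _       = refl

at-<size : ∀ t m {t'} → at t m ≡ just t' → m < size t
at-<size (leaf _)   zero    _ = z<s
at-<size (node _ _) zero    _ = z<s
at-<size (node l r) (suc m) at-m with m <ᵇ size l | <ᵇ-reflects-< m (size l)
... | true  | ofʸ m<l = s≤s (≤-trans m<l (m≤m+n (size l) (size r)))
... | false | ofⁿ m≮l =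
  s≤s (subst (_< size l + size r) (m+[n∸m]≡n (≮⇒≥ m≮l))
             (+-monoʳ-< (size l) (at-<size r (m ∸ size l) at-m)))

at-defined : ∀ t m → m < size t → ∃[ t' ] at t m ≡ just t'
at-defined t          zero    _         = t , refl
at-defined (leaf _)   (suc _) (s≤s ())
at-defined (node l r) (suc m) (s≤s m<) with m <ᵇ size l | <ᵇ-reflects-< m (size l)
... | true  | ofʸ m<l = at-defined l m m<l
... | false | ofⁿ m≮l =
  at-defined r (m ∸ size l)
    (+-cancelˡ-< (size l) _ _ (subst (_< size l + size r) (sym (m+[n∸m]≡n (≮⇒≥ m≮l))) m<))

at-+ : ∀ v i {t} m {t'} → at v i ≡ just t → at t m ≡ just t' → at v (i + m) ≡ just t'
at-+ v          zero    m refl at-m = at-m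
at-+ (node l r) (suc i) m at-i at-m with i <ᵇ size l | <ᵇ-reflects-< i (size l)
... | true  | _ = trans (at-node-left (at-<size l (i + m) at-im)) at-im
  where at-im = at-+ l i m at-i at-m
... | false | ofⁿ i≮l =
  trans (at-node-right (≤-trans l≤i (m≤m+n i m)))
        (trans (cong (at r) (+-∸-comm m l≤i)) (at-+ r (i ∸ size l) m at-i at-m))
  where l≤i = ≮⇒≥ i≮l

at-below : ∀ v i {l r} n {t} → at v i ≡ just (node l r) → at (node l r) (suc n) ≡ just t →
           at v (suc (i + n)) ≡ just t
at-below v i n {t} at-i at-n =
  subst (λ j → at v j ≡ just t) (+-suc i n) (at-+ v i (suc n) at-i at-n)

at-⊆ : ∀ t m {t'} → at t m ≡ just t' → leaves t' ⊆ leaves t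
at-⊆ t          zero    refl x∈ = x∈
at-⊆ (node l r) (suc m) at-m x∈ with m <ᵇ size l
... | true  = xs⊆xs++ys (leaves l) (leaves r) (at-⊆ l m at-m x∈)
... | false = xs⊆ys++xs (leaves r) (leaves l) (at-⊆ r (m ∸ size l) at-m x∈)

at-node-side : ∀ l r m {t} → at (node l r) (suc m) ≡ just t →
               leaves t ⊆ leaves l ⊎ leaves t ⊆ leaves r
at-node-side l r m at-m with m <ᵇ size l
... | true  = inj₁ (at-⊆ l m at-m)
... | false = inj₂ (at-⊆ r (m ∸ size l) at-m)

unique-++⁻ˡ : ∀ xs {ys : List ℕ} → Unique (xs ++ ys) → Unique xs
unique-++⁻ˡ []       _          = []
unique-++⁻ˡ (x ∷ xs) (x∉ ∷ xs!) = All.++⁻ˡ xs x∉ ∷ unique-++⁻ˡ xs xs!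

unique-++⁻ʳ : ∀ xs {ys : List ℕ} → Unique (xs ++ ys) → Unique ys
unique-++⁻ʳ []       ys!       = ys!
unique-++⁻ʳ (x ∷ xs) (_ ∷ xs!) = unique-++⁻ʳ xs xs!

unique-++⇒disjoint : ∀ xs {ys : List ℕ} → Unique (xs ++ ys) → Disjoint xs ys
unique-++⇒disjoint (x ∷ xs) (x∉ ∷ _)   (here refl , y∈ys) =
  All.lookup (All.++⁻ʳ xs x∉) y∈ys refl
unique-++⇒disjoint (x ∷ xs) (_  ∷ xs!) (there y∈xs , y∈ys) =
  unique-++⇒disjoint xs xs! (y∈xs , y∈ys)

at-unique : ∀ t m {t'} → Unique (leaves t) → at t m ≡ just t' → Unique (leaves t')
at-unique t          zero    t! refl = t!
at-unique (node l r) (suc m) t! at-m with m <ᵇ size l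
... | true  = at-unique l m (unique-++⁻ˡ (leaves l) t!) at-m
... | false = at-unique r (m ∸ size l) (unique-++⁻ʳ (leaves l) t!) at-m

node-disjoint : ∀ {v k l r} → WFVtree v → atℤ v k ≡ just (node l r) →
                Disjoint (leaves l) (leaves r)
node-disjoint {k = + i} wf at-k = unique-++⇒disjoint _ (at-unique _ i wf at-k)

leftDesc-subtree : ∀ {v k j l r} → atℤ v k ≡ just (node l r) → LeftDesc v k j →
                   ∃[ t ] (atℤ v j ≡ just t × leaves t ⊆ leaves l)
leftDesc-subtree {v} {l = l} at-k (i , _ , refl , refl , _ , _ , at-i , i<j , j<)
  with trans (sym at-k) at-i | m≤n⇒∃[o]m+o≡n i<j
... | refl | m , refl with at-defined l m (+-cancelˡ-< (suc i) m (size l) j<)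
... | t , at-m =
  t , at-below v i m at-k (trans (at-node-left (at-<size l m at-m)) at-m) , at-⊆ l m at-m

rightDesc-subtree : ∀ {v k j l r} → atℤ v k ≡ just (node l r) → RightDesc v k j →
                    ∃[ t ] (atℤ v j ≡ just t × leaves t ⊆ leaves r)
rightDesc-subtree {v} {l = l} {r} at-k (i , _ , refl , refl , _ , _ , at-i , i<j , j<)
  with trans (sym at-k) at-i | m≤n⇒∃[o]m+o≡n i<j
... | refl | m , refl with at-defined r m (+-cancelˡ-< (suc i + size l) m (size r) j<)
... | t , at-m = t , at-j , at-⊆ r m at-m
  where
  at-lm : at (node l r) (suc (size l + m)) ≡ just t
  at-lm = trans (at-node-right (m≤m+n (size l) m))
                (trans (cong (at r) (m+n∸m≡n (size l) m)) at-m)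
  at-j : at v (suc (i + size l + m)) ≡ just t
  at-j = subst (λ n → at v (suc n) ≡ just t) (sym (+-assoc i (size l) m))
               (at-below v i _ at-k at-lm)

properDesc-side : ∀ {v i j l r t} → at v i ≡ just (node l r) → ProperDesc v i j →
                  at v j ≡ just t → leaves t ⊆ leaves l ⊎ leaves t ⊆ leaves r
properDesc-side {v} {i} {l = l} {r} at-i ((_ , at-i' , _ , j<) , i<j) at-j
  with trans (sym at-i) at-i' | m≤n⇒∃[o]m+o≡n i<j
... | refl | m , refl
  with at-defined (node l r) (suc m)
         (+-cancelˡ-< i (suc m) _ (subst (_< i + size (node l r)) (sym (+-suc i m)) j<))
... | t' , at-m with trans (sym at-j) (at-below v i m at-i at-m)
... | refl = at-node-side l r m at-m

leaf-¬properDesc : ∀ {v i j x} → at v i ≡ just (leaf x) → ¬ ProperDesc v i j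
leaf-¬properDesc {i = i} {j} at-i ((_ , at-i' , _ , j<) , i<j) with trans (sym at-i) at-i'
... | refl = <⇒≱ i<j (m<1+n⇒m≤n (subst (j <_) (+-comm i 1) j<))

update-≡ : ∀ a X b → update a X b X ≡ b
update-≡ a X b with X ≡ᵇ X | ≡⇒≡ᵇ X X refl
... | true  | _  = refl
... | false | ()

update-≢ : ∀ a {X y} b → y ≢ X → update a X b y ≡ a y
update-≢ a {X} {y} b y≢X with y ≡ᵇ X | ≡ᵇ⇒≡ y X
... | true  | y≡X = contradiction (y≡X _) y≢X
... | false | _   = refl

Agree : List ℕ → Assignment → Assignment → Set
Agree S a b = ∀ {y} → y ∈ S → a y ≡ b y

DependsOnlyOn : BoolFun → List ℕ → Set
DependsOnlyOn f S = ∀ a b → Agree S a b → f a ≡ f b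

dependsOnlyOn-mono : ∀ {f S T} → S ⊆ T → DependsOnlyOn f S → DependsOnlyOn f T
dependsOnlyOn-mono S⊆T f-S a b ag = f-S a b (λ y∈S → ag (S⊆T y∈S))

constant⇒dependsOnlyOn : ∀ {f c} S → (∀ a → f a ≡ c) → DependsOnlyOn f S
constant⇒dependsOnlyOn _ f≡c a b _ = trans (f≡c a) (sym (f≡c b))

update-agree : ∀ {S a b} X → Agree S a b → Agree (X ∷ S) (update a X (b X)) b
update-agree {a = a} {b} X _  (here refl) = update-≡ a X (b X)
update-agree {a = a} {b} X ag {y} (there y∈S) with y ≟ X
... | yes refl = update-≡ a X (b X)
... | no  y≢X  = trans (update-≢ a (b X) y≢X) (ag y∈S)

essential∈support : ∀ {f S X} → DependsOnlyOn f S → DependsOn f X → X ∈ S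
essential∈support {f} {S} {X} f-S dep with X ∈? S
... | yes X∈S = X∈S
... | no  X∉S = contradiction (λ a → f-S _ _ (update-outside a)) dep
  where
  update-outside : ∀ a → Agree S (update a X true) (update a X false)
  update-outside a {y} y∈S = trans (update-≢ a true y≢X) (sym (update-≢ a false y≢X))
    where
    y≢X : y ≢ X
    y≢X y≡X = X∉S (subst (_∈ S) y≡X y∈S)

-- DependsOn is a negation, so an inessential variable is only known to be irrelevant under ¬ ¬.
drop-inessential : ∀ {f X S} → ¬ DependsOn f X → DependsOnlyOn f (X ∷ S) →
                   ¬ ¬ DependsOnlyOn f S
drop-inessential {f} {X} ¬dep f-XS ¬f-S = ¬dep λ flip → ¬f-S λ a b ag → begin
  f a                   ≡⟨ f-XS _ a (update-agree X λ _ → refl) ⟨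
  f (update a X (a X))  ≡⟨ irrelevant flip a (a X) (b X) ⟩
  f (update a X (b X))  ≡⟨ f-XS _ b (update-agree X ag) ⟩
  f b                   ∎
  where
  open ≡-Reasoning
  irrelevant : (∀ a → f (update a X true) ≡ f (update a X false)) →
               ∀ a c c' → f (update a X c) ≡ f (update a X c')
  irrelevant flip a true  true  = refl
  irrelevant flip a true  false = flip a
  irrelevant flip a false true  = sym (flip a)
  irrelevant flip a false false = refl

essential-support : ∀ {f} S {T} → DependsOnlyOn f S → (∀ X → DependsOn f X → X ∈ T) →
                    ¬ ¬ DependsOnlyOn f T
essential-support {f} S {T} f-S ess = go S (dependsOnlyOn-mono (xs⊆xs++ys S T) f-S)
  where
  go : ∀ S → DependsOnlyOn f (S ++ T) → ¬ ¬ DependsOnlyOn f T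
  go []      f-T ¬f-T = ¬f-T f-T
  go (X ∷ S) f-XST with X ∈? T
  ... | yes X∈T = go S (dependsOnlyOn-mono drop f-XST)
    where
    drop : (X ∷ S) ++ T ⊆ S ++ T
    drop (here refl) = ∈-++⁺ʳ S X∈T
    drop (there y∈)  = y∈
  ... | no  X∉T = λ ¬f-T → drop-inessential (X∉T ∘ ess X) f-XST (λ f-ST → go S f-ST ¬f-T)

witnesses⇒nonTrivial : ∀ {f a b} → f a ≡ true → f b ≡ false → NonTrivial f
witnesses⇒nonTrivial {a = a} {b} fa≡true fb≡false =
  (λ all-true → not-¬ (all-true b) fb≡false) , (λ all-false → not-¬ (all-false a) fa≡true)

splice : List ℕ → Assignment → Assignment → Assignment
splice S a b y = if does (y ∈? S) then a y else b y

splice-agreeˡ : ∀ S a b → Agree S (splice S a b) a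
splice-agreeˡ S a b {y} y∈S with y ∈? S
... | yes _   = refl
... | no  y∉S = contradiction y∈S y∉S

splice-agreeʳ : ∀ {S T} a b → Disjoint S T → Agree T (splice S a b) b
splice-agreeʳ {S} a b S#T {y} y∈T with y ∈? S
... | yes y∈S = contradiction (y∈S , y∈T) S#T
... | no  _   = refl

litVal-leaf : ∀ v k {x} → atℤ v k ≡ just (leaf x) → ∀ a → litVal v k a ≡ a x
litVal-leaf v k at-k a rewrite at-k = refl

litVal-local : ∀ v k {x} → atℤ v k ≡ just (leaf x) → DependsOnlyOn (litVal v k) (x ∷ [])
litVal-local v k at-k a b ag =
  trans (litVal-leaf v k at-k a) (trans (ag (here refl)) (sym (litVal-leaf v k at-k b)))

primeFun : VT → ℤ → Elem → BoolFun
primeFun v k (elem p d _ _) = sem v p (d +ℤ k)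

subFun : VT → ℤ → Elem → BoolFun
subFun v k (elem _ _ s e) = sem v s (e +ℤ k)

ValidElem : VT → ℤ → Elem → Set
ValidElem v k (elem p d s e) =
  LeftDesc v k (d +ℤ k) × RightDesc v k (e +ℤ k) × Valid v p (d +ℤ k) × Valid v s (e +ℤ k)

sem-local   : ∀ {v α k t} → Valid v α k → atℤ v k ≡ just t →
              DependsOnlyOn (sem v α k) (leaves t)
semL-local  : ∀ {v es k l r} → ValidL v es k → atℤ v k ≡ just (node l r) →
              DependsOnlyOn (semL v es k) (leaves l ++ leaves r)
prime-local : ∀ {v k l r} x → ValidElem v k x → atℤ v k ≡ just (node l r) →
              DependsOnlyOn (primeFun v k x) (leaves l)
sub-local   : ∀ {v k l r} x → ValidElem v k x → atℤ v k ≡ just (node l r) →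
              DependsOnlyOn (subFun v k x) (leaves r)

sem-local {α = top} _ _ _ _ _ = refl
sem-local {α = bot} _ _ _ _ _ = refl
sem-local {v} {pos} {k} (_ , at-leaf) at-t with trans (sym at-leaf) at-t
... | refl = litVal-local v k at-leaf
sem-local {v} {neg} {k} (_ , at-leaf) at-t a b ag with trans (sym at-leaf) at-t
... | refl = cong not (litVal-local v k at-leaf a b ag)
sem-local {α = dec _} ((_ , _ , at-k) , valid , _) at-t with trans (sym at-k) at-t
... | refl = semL-local valid at-k

semL-local {es = []} _ _ _ _ _ = refl
semL-local {es = x@(elem _ _ _ _) ∷ _} (ld , rd , vp , vs , valid) at-k a b ag =
  cong₂ _∨_ (cong₂ _∧_ (prime-local x (ld , rd , vp , vs) at-k a b (ag ∘ ∈-++⁺ˡ))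
                       (sub-local x (ld , rd , vp , vs) at-k a b (ag ∘ ∈-++⁺ʳ _)))
            (semL-local valid at-k a b ag)

prime-local (elem _ _ _ _) (ld , _ , vp , _) at-k with leftDesc-subtree at-k ld
... | _ , at-t , t⊆l = dependsOnlyOn-mono t⊆l (sem-local vp at-t)

sub-local (elem _ _ _ _) (_ , rd , _ , vs) at-k with rightDesc-subtree at-k rd
... | _ , at-t , t⊆r = dependsOnlyOn-mono t⊆r (sem-local vs at-t)

covers : ∀ v α i {t} → Valid v α (+ i) → at v i ≡ just t → Covers v i (sem v α (+ i))
covers _ _ _ valid at-i = _ , at-i , λ X → essential∈support (sem-local valid at-i)

primeSem-lookup : ∀ v es k i → primeSem v es k i ≡ primeFun v k (lookup es i)
primeSem-lookup v es k i with lookup es i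
... | elem _ _ _ _ = refl

subSem-lookup : ∀ v es k i → subSem v es k i ≡ subFun v k (lookup es i)
subSem-lookup v es k i with lookup es i
... | elem _ _ _ _ = refl

lookup-valid : ∀ {v k} es → ValidL v es k → ∀ i → ValidElem v k (lookup es i)
lookup-valid (elem _ _ _ _ ∷ _)  (ld , rd , vp , vs , _) zero    = ld , rd , vp , vs
lookup-valid (elem _ _ _ _ ∷ es) (_ , _ , _ , _ , valid) (suc i) = lookup-valid es valid i

semL-false : ∀ {v k a} es → (∀ j → primeFun v k (lookup es j) a ≡ false) →
             semL v es k a ≡ false
semL-false []                  _        = refl
semL-false (elem _ _ _ _ ∷ es) false-at rewrite false-at zero = semL-false es (false-at ∘ suc)

semL-lookup : ∀ {v k a} es i → (∀ j → j ≢ i → primeFun v k (lookup es j) a ≡ false) →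
              primeFun v k (lookup es i) a ≡ true → semL v es k a ≡ subFun v k (lookup es i) a
semL-lookup (elem _ _ _ _ ∷ es) zero others p-true
  rewrite p-true | semL-false es (λ j → others (suc j) λ ()) = ∨-identityʳ _
semL-lookup (elem _ _ _ _ ∷ es) (suc i) others p-true rewrite others zero (λ ()) =
  semL-lookup es i (λ j j≢i → others (suc j) (j≢i ∘ Fin.suc-injective)) p-true

semL-prime : ∀ {v es k a} i → IsPartition v es k → primeSem v es k i a ≡ true →
             semL v es k a ≡ subSem v es k i a
semL-prime {v} {es} {k} {a} i (disjoint , _) p-true = begin
  semL v es k a               ≡⟨ semL-lookup es i others (trans (sym (prime≡ i)) p-true) ⟩
  subFun v k (lookup es i) a  ≡⟨ cong-app (subSem-lookup v es k i) a ⟨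
  subSem v es k i a           ∎
  where
  open ≡-Reasoning
  prime≡ : ∀ j → primeSem v es k j a ≡ primeFun v k (lookup es j) a
  prime≡ j = cong-app (primeSem-lookup v es k j) a
  others : ∀ j → j ≢ i → primeFun v k (lookup es j) a ≡ false
  others j j≢i =
    trans (sym (prime≡ j))
          (trans (cong (_∧ primeSem v es k j a) (sym p-true)) (disjoint i j (j≢i ∘ sym) a))

module Decomposition (v : VT) (es : List Elem) (k : ℤ) {l r}
                     (wf : WFVtree v) (at-k : atℤ v k ≡ just (node l r))
                     (valid : ValidL v es k) (partition : IsPartition v es k) where

  f : BoolFun
  f = semL v es k

  l#r : Disjoint (leaves l) (leaves r)
  l#r = node-disjoint {k = k} wf at-k

  witness : Fin (length es) → Assignment
  witness i = proj₁ (proj₂ (proj₂ partition) i)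

  primeSem-local : ∀ i → DependsOnlyOn (primeSem v es k i) (leaves l)
  primeSem-local i = subst (λ g → DependsOnlyOn g (leaves l)) (sym (primeSem-lookup v es k i))
                           (prime-local (lookup es i) (lookup-valid es valid i) at-k)

  subSem-local : ∀ i → DependsOnlyOn (subSem v es k i) (leaves r)
  subSem-local i = subst (λ g → DependsOnlyOn g (leaves r)) (sym (subSem-lookup v es k i))
                         (sub-local (lookup es i) (lookup-valid es valid i) at-k)

  f-splice : ∀ i b → f (splice (leaves l) (witness i) b) ≡ subSem v es k i b
  f-splice i b = begin
    f (splice (leaves l) (witness i) b)
      ≡⟨ semL-prime {v} {es} {k} i partition prime-true ⟩
    subSem v es k i (splice (leaves l) (witness i) b)
      ≡⟨ subSem-local i _ b (splice-agreeʳ (witness i) b l#r) ⟩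
    subSem v es k i b
      ∎
    where
    open ≡-Reasoning
    prime-true : primeSem v es k i (splice (leaves l) (witness i) b) ≡ true
    prime-true = trans (primeSem-local i _ (witness i) (splice-agreeˡ (leaves l) (witness i) b))
                       (proj₂ (proj₂ (proj₂ partition) i))

  left-local⇒subs-constant : DependsOnlyOn f (leaves l) →
                             ∀ i b → subSem v es k i b ≡ f (witness i)
  left-local⇒subs-constant f-l i b =
    trans (sym (f-splice i b)) (f-l _ (witness i) (splice-agreeˡ (leaves l) (witness i) b))

  right-local⇒subs-equal : DependsOnlyOn f (leaves r) →
                           ∀ i j b → subSem v es k i b ≡ subSem v es k j b
  right-local⇒subs-equal f-r i j b = begin
    subSem v es k i b                    ≡⟨ f-splice i b ⟨
    f (splice (leaves l) (witness i) b)  ≡⟨ f-r _ _ same-on-r ⟩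
    f (splice (leaves l) (witness j) b)  ≡⟨ f-splice j b ⟩
    subSem v es k j b                    ∎
    where
    open ≡-Reasoning
    same-on-r : Agree (leaves r) (splice (leaves l) (witness i) b) (splice (leaves l) (witness j) b)
    same-on-r y∈r =
      trans (splice-agreeʳ (witness i) b l#r y∈r) (sym (splice-agreeʳ (witness j) b l#r y∈r))

  left-local⇒witness-values-distinct : IsCompressedPartition v es k → DependsOnlyOn f (leaves l) →
                                       ∀ {i j} → i ≢ j → f (witness i) ≢ f (witness j)
  left-local⇒witness-values-distinct distinct f-l i≢j fᵢ≡fⱼ = distinct _ _ i≢j λ b →
    trans (left-local⇒subs-constant f-l _ b)
          (trans fᵢ≡fⱼ (sym (left-local⇒subs-constant f-l _ b)))

  compressed⇒¬right-local : IsCompressedPartition v es k → ∀ {i j} → i ≢ j →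
                            ¬ DependsOnlyOn f (leaves r)
  compressed⇒¬right-local distinct i≢j f-r = distinct _ _ i≢j (right-local⇒subs-equal f-r _ _)

  compressed⇒nonTrivial : IsCompressedPartition v es k → ∀ {i j} → i ≢ j → NonTrivial f
  compressed⇒nonTrivial distinct i≢j =
    compressed⇒¬right-local distinct i≢j ∘ constant⇒dependsOnlyOn _ ,
    compressed⇒¬right-local distinct i≢j ∘ constant⇒dependsOnlyOn _

Canonical : VT → Struct → ℤ → Set
Canonical v α k =
  ((∀ a → sem v α k a ≡ false) → α ≡ bot) × ((∀ a → sem v α k a ≡ true) → α ≡ top)

nonTrivial⇒canonical : ∀ v α k → NonTrivial (sem v α k) → Canonical v α k
nonTrivial⇒canonical _ _ _ (¬all-true , ¬all-false) = ⊥-elim ∘ ¬all-false , ⊥-elim ∘ ¬all-true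

canonical    : ∀ {v α k} → WFVtree v → Valid v α k → Compressed v α k → Trimmed α →
               Canonical v α k
two-elements : ∀ {v es k} → WFVtree v → Valid v (dec es) k → Compressed v (dec es) k →
               Trimmed (dec es) →
               ∃[ x₀ ] ∃[ x₁ ] ∃[ es' ] (es ≡ x₀ ∷ x₁ ∷ es')

canonical {α = top} _ _ _ _ = (λ all-false → contradiction (all-false (λ _ → true)) λ ()) , λ _ → refl
canonical {α = bot} _ _ _ _ = (λ _ → refl) , (λ all-true → contradiction (all-true (λ _ → true)) λ ())
canonical {v} {pos} {k} _ (_ , at-leaf) _ _ =
  nonTrivial⇒canonical v pos k
    (witnesses⇒nonTrivial {sem v pos k} (litVal-leaf v k at-leaf (λ _ → true))
                                         (litVal-leaf v k at-leaf (λ _ → false)))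
canonical {v} {neg} {k} _ (_ , at-leaf) _ _ =
  nonTrivial⇒canonical v neg k
    (witnesses⇒nonTrivial {sem v neg k} (cong not (litVal-leaf v k at-leaf (λ _ → false)))
                                         (cong not (litVal-leaf v k at-leaf (λ _ → true))))
canonical {α = dec _} wf valid compressed trimmed with two-elements wf valid compressed trimmed
canonical {v} {dec es} {k} wf ((_ , _ , at-k) , ves , partition) (distinct , _) _ | _ , _ , _ , refl =
  nonTrivial⇒canonical v (dec es) k
    (Decomposition.compressed⇒nonTrivial v es k wf at-k ves partition distinct
                                          {zero} {suc zero} λ ())

two-elements {es = []} _ (_ , _ , _ , cover , _) _ _ with cover (λ _ → false)
... | () , _
two-elements {v} {elem p d s e ∷ []} {k} wf (_ , (_ , _ , vp , _) , _ , cover , _) (_ , cp , _)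
             (untrimmed , tp , _) =
  ⊥-elim (untrimmed (inj₁ (d , s , e , cong (λ q → elem q d s e ∷ []) p≡top)))
  where
  prime-true : ∀ a → sem v p (d +ℤ k) a ≡ true
  prime-true a with cover a
  ... | zero , p-true = p-true
  p≡top : p ≡ top
  p≡top = proj₂ (canonical wf vp cp tp) prime-true
two-elements {es = _ ∷ _ ∷ _} _ _ _ _ = _ , _ , _ , refl

complementary-subs-untrimmed :
  ∀ {v k p₀ d₀ s₀ e₀ p₁ d₁ s₁ e₁} c → Canonical v s₀ (e₀ +ℤ k) → Canonical v s₁ (e₁ +ℤ k) →
  (∀ b → sem v s₀ (e₀ +ℤ k) b ≡ c) → (∀ b → sem v s₁ (e₁ +ℤ k) b ≡ not c) →
  ¬ Trimmed (dec (elem p₀ d₀ s₀ e₀ ∷ elem p₁ d₁ s₁ e₁ ∷ []))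
complementary-subs-untrimmed true (_ , top-if-true) (bot-if-false , _) s₀-true s₁-false (untrimmed , _)
  with top-if-true s₀-true | bot-if-false s₁-false
... | refl | refl = untrimmed (inj₂ (inj₁ (_ , _ , _ , _ , _ , _ , refl)))
complementary-subs-untrimmed false (bot-if-false , _) (_ , top-if-true) s₀-false s₁-true (untrimmed , _)
  with bot-if-false s₀-false | top-if-true s₁-true
... | refl | refl = untrimmed (inj₂ (inj₂ (_ , _ , _ , _ , _ , _ , refl)))

¬dependsOnlyOn-left : ∀ {v es k l r} → WFVtree v → atℤ v k ≡ just (node l r) →
                      Valid v (dec es) k → Compressed v (dec es) k → Trimmed (dec es) →
                      ¬ DependsOnlyOn (semL v es k) (leaves l)
¬dependsOnlyOn-left wf at-k valid compressed trimmed f-l with two-elements wf valid compressed trimmed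
¬dependsOnlyOn-left {v} {es} {k} wf at-k (_ , ves , partition) (distinct , _) _ f-l
  | _ , _ , _ ∷ _ , refl =
  -- three pairwise distinct Booleans
  value≢ {suc zero} {suc (suc zero)} (λ ())
    (trans (¬-not (value≢ {suc zero} {zero} λ ()))
           (sym (¬-not (value≢ {suc (suc zero)} {zero} λ ()))))
  where
  open Decomposition v es k wf at-k ves partition
  value≢ : ∀ {i j} → i ≢ j → f (witness i) ≢ f (witness j)
  value≢ = left-local⇒witness-values-distinct distinct f-l
¬dependsOnlyOn-left {v} {es} {k} wf at-k
  (_ , ves@(_ , _ , _ , vs₀ , _ , _ , _ , vs₁ , _) , partition) (distinct , _ , cs₀ , _ , cs₁ , _)
  trimmed@(_ , _ , ts₀ , _ , ts₁ , _) f-l | elem _ _ _ _ , elem _ _ _ _ , [] , refl =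
  complementary-subs-untrimmed (f (witness zero))
    (canonical wf vs₀ cs₀ ts₀) (canonical wf vs₁ cs₁ ts₁)
    (left-local⇒subs-constant f-l zero)
    (λ b → trans (left-local⇒subs-constant f-l (suc zero) b)
                 (¬-not (left-local⇒witness-values-distinct distinct f-l {suc zero} {zero} λ ())))
    trimmed
  where open Decomposition v es k wf at-k ves partition

¬dependsOnlyOn-right : ∀ {v es k l r} → WFVtree v → atℤ v k ≡ just (node l r) →
                       Valid v (dec es) k → Compressed v (dec es) k → Trimmed (dec es) →
                       ¬ DependsOnlyOn (semL v es k) (leaves r)
¬dependsOnlyOn-right wf at-k valid compressed trimmed with two-elements wf valid compressed trimmed
¬dependsOnlyOn-right {v} {es} {k} wf at-k (_ , ves , partition) (distinct , _) _ | _ , _ , _ , refl =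
  Decomposition.compressed⇒¬right-local v es k wf at-k ves partition distinct {zero} {suc zero} λ ()

essential-node : ∀ {v α k} → WFVtree v → Valid v α k → Compressed v α k → Trimmed α →
                 NonTrivial (sem v α k) → ∃[ i ] (k ≡ + i × EssDepNode v (sem v α k) i)
essential-node {α = top} _ _ _ _ (¬all-true , _)  = ⊥-elim (¬all-true λ _ → refl)
essential-node {α = bot} _ _ _ _ (_ , ¬all-false) = ⊥-elim (¬all-false λ _ → refl)
essential-node {v} {pos} {+ i} _ valid@(_ , at-leaf) _ _ nt =
  i , refl , nt , covers v pos i valid at-leaf , λ _ proper _ → leaf-¬properDesc at-leaf proper
essential-node {v} {neg} {+ i} _ valid@(_ , at-leaf) _ _ nt =
  i , refl , nt , covers v neg i valid at-leaf , λ _ proper _ → leaf-¬properDesc at-leaf proper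
essential-node {v} {dec es} {+ i} wf valid@((_ , _ , at-k) , ves , _) compressed trimmed nt =
  i , refl , nt , covers v (dec es) i valid at-k , no-proper-cover
  where
  no-proper-cover : ∀ j → ProperDesc v i j → ¬ Covers v j (semL v es (+ i))
  no-proper-cover j proper (t , at-j , cover) with properDesc-side at-k proper at-j
  ... | inj₁ t⊆l = essential-support _ (semL-local ves at-k) (λ X → t⊆l ∘ cover X)
                     (¬dependsOnlyOn-left wf at-k valid compressed trimmed)
  ... | inj₂ t⊆r = essential-support _ (semL-local ves at-k) (λ X → t⊆r ∘ cover X)
                     (¬dependsOnlyOn-right wf at-k valid compressed trimmed)

lemma2 : (v : VT) → WFVtree v → (α : Struct) (k : ℤ) →
    Valid v α k → Compressed v α k → Trimmed α →
    ((∀ a → sem v α k a ≡ false) → α ≡ bot)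
    × ((∀ a → sem v α k a ≡ true) → α ≡ top)
    × (NonTrivial (sem v α k) → ∃[ i ] (k ≡ + i × EssDepNode v (sem v α k) i))
lemma2 v wf α k valid compressed trimmed =
  let bot-if-false , top-if-true = canonical wf valid compressed trimmed
  in  bot-if-false , top-if-true , essential-node wf valid compressed trimmed
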